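{- For $n>0$, we have $a(m)>a(n)$ for all $m>n$ if and only if the Fibonacci representation $(n)_F$ belongs to the language described by the regular expression $10(100^*10)^*0^*$.
   Context: Fibonacci numbers: $F_0=0$, $F_1=1$, $F_n=F_{n-1}+F_{n-2}$. The sequence $(a(n))_{n\geq 0}$ is defined by $a(n)=n$ for $n\le 1$, and $a(n)=F_{j+1}-a(n-F_j)$ if $F_j<n\le F_{j+1}$ with $j\ge 2$. The Fibonacci (Zeckendorf) representation $(n)_F$ of $n\ge1$ is the unique bit string $e_1\cdots e_t$ with $e_1=1$, no two consecutive $1$'s, and $n=\sum_{i=1}^t e_iF_{t-i+2}$. In the regular expression, juxtaposition is concatenation and $x^*$ denotes zero or more repetitions of $x$. -}

module Defs where

open import Data.Nat using (ℕ; zero; suc; _+_; _∸_; _≤ᵇ_)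
open import Data.Integer using (ℤ; +_; _-_)
open import Data.Bool using (Bool; true; false; if_then_else_)
open import Data.List using (List; []; _∷_)
open import Data.Bool.Properties using (≤-preorder)
import Text.Regex.Base

F : ℕ → ℕ
F zero = zero
F (suc zero) = suc zero
F (suc (suc n)) = F (suc n) + F n

-- For n ≥ 2, findJ-from n = the unique j ≥ 2 with F j < n ≤ F (j+1)
-- (F 2 = 1 < n, and F is nondecreasing, so the least such j works;
--  fuel n suffices since F (n+1) ≥ n).
findJ : (fuel n k : ℕ) → ℕ
findJ zero n k = k
findJ (suc fuel) n k = if n ≤ᵇ F (suc k) then k else findJ fuel n (suc k)

jOf : ℕ → ℕ
jOf n = findJ n n 2

-- a(n) = n for n ≤ 1; a(n) = F(j+1) - a(n - F j) for F j < n ≤ F (j+1), j ≥ 2.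
-- Defined with fuel: the argument strictly decreases (F j ≥ 1), so fuel n
-- suffices. Values taken in ℤ so that the subtraction is the true one.
a-fuel : (fuel n : ℕ) → ℤ
a-fuel _ zero = + 0
a-fuel _ (suc zero) = + 1
a-fuel zero (suc (suc n)) = + 0
a-fuel (suc fuel) (suc (suc n)) =
  + F (suc (jOf (suc (suc n)))) - a-fuel fuel (suc (suc n) ∸ F (jOf (suc (suc n))))

a : ℕ → ℤ
a n = a-fuel n n

topIdx-go : (fuel n i : ℕ) → ℕ
topIdx-go zero n i = i
topIdx-go (suc fuel) n i = if F (suc i) ≤ᵇ n then topIdx-go fuel n (suc i) else i

topIdx : ℕ → ℕ
topIdx n = topIdx-go n n 2

-- greedy-bits k r : bits for weights F (k+2), F (k+1), …, F 2 (k+1 bits),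
-- most significant first, greedily subtracting from r.
greedy-bits : (k r : ℕ) → List Bool
greedy-bits zero r = (if F 2 ≤ᵇ r then true else false) ∷ []
greedy-bits (suc k) r =
  if F (suc (suc (suc k))) ≤ᵇ r
  then true ∷ greedy-bits k (r ∸ F (suc (suc (suc k))))
  else false ∷ greedy-bits k r

-- (n)_F = e_1 … e_t with n = Σ e_i F (t - i + 2); here t = topIdx n - 1.
zeck : ℕ → List Bool
zeck n = greedy-bits (topIdx n ∸ 2) n

-- Regular expressions over the alphabet Bool (false = 0, true = 1),
-- using the standard library's Text.Regex.
open Text.Regex.Base ≤-preorder public
  using (Exp; ε; _∣_; _∙_; _⋆; singleton)
  renaming (_∈_ to _∈L_)

b0 b1 : Exp
b0 = singleton false
b1 = singleton true

language : Exp
language = b1 ∙ b0 ∙ (b1 ∙ b0 ∙ (b0 ⋆) ∙ b1 ∙ b0) ⋆ ∙ (b0 ⋆)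

{-# OPTIONS --safe #-}
-- Write n = F j + x with F j < n ≤ F (j+1). From a (F j + x) = F (j+1) − a x one gets by induction
-- that a maps (F j, F (j+1)] into [F j, F (j+1)), so a n < a m for all m > n iff this holds for
-- n < m ≤ F (j+1); as x ↦ F (j+1) − a x reverses order, that means a x > a y for x < y ≤ F (j−1),
-- and a second reflection turns this back into a suffix-minimum condition. Hence F (j+1)
-- (digits 10…0) is a suffix minimum, F j + k with k ≤ F (j−2) (digits 1010…0 or 100…1…) is not,
-- as a (F (j+1)) ≤ a n, and F j + F (j−2) + l with l < F (j−3) (digits 1010 0ᵃ (l)_F) is one iff
-- l is. The language 10(100*10)*0* satisfies the same recursion on digit strings.
module Submission where

open import Defs
open import Data.Nat using (ℕ; zero; suc; _+_; _∸_; _≤_; _<_; z≤n; s≤s; s≤s⁻¹; _≤ᵇ_; _≤?_)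
open import Data.Nat.Properties
open import Data.Nat.Induction using (<-rec)
open import Data.Integer as ℤ using (ℤ; +_; +≤+; +<+)
  renaming (_≤_ to _≤ℤ_; _<_ to _<ℤ_; _-_ to _-ℤ_)
import Data.Integer.Properties as ℤ
import Algebra.Properties.AbelianGroup ℤ.+-0-abelianGroup as ℤ+
open import Data.Bool using (Bool; true; false)
import Data.Bool.Properties as Bool
open import Data.List using (List; []; _∷_; _++_; replicate)
open import Data.List.Properties using (++-assoc)
open import Data.List.Relation.Unary.All using (All; []; _∷_)
open import Data.List.Relation.Unary.All.Properties using (++⁻ʳ; replicate⁺)
open import Data.List.Relation.Unary.Any using (here)
import Data.List.Relation.Ternary.Appending.Propositional {A = Bool} as Appending
open import Data.Product using (∃-syntax; _×_; _,_; proj₁; proj₂; map; map₂; uncurry)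
open import Data.Sum using (inj₁; inj₂)
open import Data.Empty using (⊥-elim)
open import Function.Base using (_∘_; flip)
open import Function.Bundles using (_⇔_; mk⇔; Equivalence)
open import Function.Construct.Symmetry using (⇔-sym)
open import Function.Construct.Composition using (_⇔-∘_)
open import Function.Related.Propositional using (module EquationalReasoning)
open import Relation.Nullary using (¬_; yes; no)
open import Relation.Nullary.Decidable using (dec-true; dec-false)
open import Relation.Binary.PropositionalEquality
open import Text.Regex.Base Bool.≤-preorder using (prod; star; sum; [_]) renaming (ε to []∈ε)

1≤F[1+n] : ∀ n → 1 ≤ F (suc n)
1≤F[1+n] zero = s≤s z≤n
1≤F[1+n] (suc n) = ≤-trans (1≤F[1+n] n) (m≤m+n _ _)

F-≤-suc : ∀ n → F n ≤ F (suc n)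
F-≤-suc zero = z≤n
F-≤-suc (suc n) = m≤m+n _ _

F-mono-≤ : ∀ {m n} → m ≤ n → F m ≤ F n
F-mono-≤ {n = zero} z≤n = ≤-refl
F-mono-≤ {m} {suc n} m≤1+n with m ≤? n
... | yes m≤n = ≤-trans (F-mono-≤ m≤n) (F-≤-suc n)
... | no m≰n = ≤-reflexive (cong F (≤-antisym m≤1+n (≰⇒> m≰n)))

F-cancel-< : ∀ {m n} → F m < F n → m < n
F-cancel-< Fm<Fn = ≰⇒> λ n≤m → <⇒≱ Fm<Fn (F-mono-≤ n≤m)

F[2+n]<F[3+n] : ∀ n → F (2 + n) < F (3 + n)
F[2+n]<F[3+n] n = m<m+n (F (2 + n)) (1≤F[1+n] n)

n<F[2+n] : ∀ n → n < F (2 + n)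
n<F[2+n] zero = s≤s z≤n
n<F[2+n] (suc n) = ≤-trans (s≤s (n<F[2+n] n)) (F[2+n]<F[3+n] n)

m<n⇒∃[o>0]m+o≡n : ∀ {m n} → m < n → ∃[ o ] m + o ≡ n × 0 < o
m<n⇒∃[o>0]m+o≡n {m} {n} m<n = n ∸ m , m+[n∸m]≡n (<⇒≤ m<n) , m<n⇒0<n∸m m<n

fib-split : ∀ n → 2 ≤ n → ∃[ i ] ∃[ k ] n ≡ F (2 + i) + k × 1 ≤ k × k ≤ F (suc i)
fib-split (suc zero) (s≤s ())
fib-split (suc (suc zero)) _ = 0 , 1 , refl , ≤-refl , ≤-refl
fib-split (suc (suc (suc n))) _ with fib-split (2 + n) (s≤s (s≤s z≤n))
... | i , k , eq , 1≤k , k≤F with m≤n⇒m<n∨m≡n k≤F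
...   | inj₁ k<F = i , suc k , trans (cong suc eq) (sym (+-suc _ k)) , s≤s z≤n , k<F
...   | inj₂ refl = suc i , 1 , trans (cong suc eq) (+-comm 1 _) , ≤-refl , 1≤F[1+n] (suc i)

-- In digits: one = 1, fib = 10…0, gap = 1010…0 or 100…1…, nest = 1010 0ᵃ (l)_F.
data Shape : ℕ → Set where
  one  : Shape 1
  fib  : ∀ t → Shape (F (3 + t))
  gap  : ∀ t {k} → 1 ≤ k → k ≤ F (2 + t) → Shape (F (4 + t) + k)
  nest : ∀ t {l} → 1 ≤ l → l < F (3 + t) → Shape (F (6 + t) + (F (4 + t) + l))

shape-nested : ∀ t {l} → 1 ≤ l → l < F (suc t) → Shape (F (4 + t) + (F (2 + t) + l))
shape-nested zero 1≤l l<1 = ⊥-elim (<⇒≱ l<1 1≤l)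
shape-nested (suc zero) 1≤l l<1 = ⊥-elim (<⇒≱ l<1 1≤l)
shape-nested (suc (suc t)) 1≤l l<F = nest t 1≤l l<F

shape-block : ∀ i {k} → 1 ≤ k → k ≤ F (suc i) → Shape (F (2 + i) + k)
shape-block i 1≤k k≤F with m≤n⇒m<n∨m≡n k≤F
shape-block i 1≤k k≤F | inj₂ refl = fib i
shape-block zero 1≤k _ | inj₁ k<1 = ⊥-elim (<⇒≱ k<1 1≤k)
shape-block (suc zero) 1≤k _ | inj₁ k<1 = ⊥-elim (<⇒≱ k<1 1≤k)
shape-block (suc (suc t)) {k} 1≤k _ | inj₁ k<F with k ≤? F (2 + t)
... | yes k≤F′ = gap t 1≤k k≤F′
... | no k≰F′ with m<n⇒∃[o>0]m+o≡n (≰⇒> k≰F′)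
...   | l , refl , 1≤l = shape-nested t 1≤l (+-cancelˡ-< (F (2 + t)) l (F (suc t)) k<F)

shape : ∀ n → 1 ≤ n → Shape n
shape n 1≤n with m≤n⇒m<n∨m≡n 1≤n
... | inj₂ refl = one
... | inj₁ 1<n with fib-split n 1<n
...   | i , k , refl , 1≤k , k≤F = shape-block i 1≤k k≤F

≤⇒≤ᵇ≡true : ∀ {m n} → m ≤ n → (m ≤ᵇ n) ≡ true
≤⇒≤ᵇ≡true {m} {n} = dec-true (m ≤? n)

>⇒≤ᵇ≡false : ∀ {m n} → n < m → (m ≤ᵇ n) ≡ false
>⇒≤ᵇ≡false {m} {n} n<m = dec-false (m ≤? n) (<⇒≱ n<m)

findJ-≡ : ∀ {n j} → F j < n → n ≤ F (suc j) →
  ∀ d k fuel → d + k ≡ j → d ≤ fuel → findJ fuel n k ≡ j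
findJ-≡ lo hi zero k zero refl _ = refl
findJ-≡ lo hi zero k (suc fuel) refl _ rewrite ≤⇒≤ᵇ≡true hi = refl
findJ-≡ {n} lo hi (suc d) k (suc fuel) refl (s≤s d≤fuel)
  rewrite >⇒≤ᵇ≡false {n} (≤-<-trans (F-mono-≤ (s≤s (m≤n+m k d))) lo) =
  findJ-≡ lo hi d (suc k) fuel (+-suc d k) d≤fuel

jOf-≡ : ∀ i {n} → F (2 + i) < n → n ≤ F (3 + i) → jOf n ≡ 2 + i
jOf-≡ i {n} lo hi = findJ-≡ lo hi i 2 n (+-comm i 2) (<⇒≤ (<-trans (n<F[2+n] i) lo))

topIdx-go-≡ : ∀ {n t} → F t ≤ n → n < F (suc t) →
  ∀ d k fuel → d + k ≡ t → d ≤ fuel → topIdx-go fuel n k ≡ t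
topIdx-go-≡ lo hi zero k zero refl _ = refl
topIdx-go-≡ {n} lo hi zero k (suc fuel) refl _ rewrite >⇒≤ᵇ≡false {n = n} hi = refl
topIdx-go-≡ lo hi (suc d) k (suc fuel) refl (s≤s d≤fuel)
  rewrite ≤⇒≤ᵇ≡true (≤-trans (F-mono-≤ (s≤s (m≤n+m k d))) lo) =
  topIdx-go-≡ lo hi d (suc k) fuel (+-suc d k) d≤fuel

topIdx-≡ : ∀ t {n} → F (2 + t) ≤ n → n < F (3 + t) → topIdx n ≡ 2 + t
topIdx-≡ t {n} lo hi = topIdx-go-≡ lo hi t 2 n (+-comm t 2) (≤-trans (<⇒≤ (n<F[2+n] t)) lo)

findJ-≥ : ∀ fuel n k → k ≤ findJ fuel n k
findJ-≥ zero n k = ≤-refl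
findJ-≥ (suc fuel) n k with n ≤ᵇ F (suc k)
... | true = ≤-refl
... | false = ≤-trans (n≤1+n k) (findJ-≥ fuel n (suc k))

-- The recursion for a

2+n∸F[jOf]≤1+n : ∀ n → 2 + n ∸ F (jOf (2 + n)) ≤ 1 + n
2+n∸F[jOf]≤1+n n = ∸-monoʳ-≤ (2 + n) (F-mono-≤ (findJ-≥ (2 + n) (2 + n) 2))

a-fuel-stable : ∀ {f g} n → n ≤ f → n ≤ g → a-fuel f n ≡ a-fuel g n
a-fuel-stable zero _ _ = refl
a-fuel-stable (suc zero) _ _ = refl
a-fuel-stable {suc f} {suc g} (suc (suc n)) (s≤s n<f) (s≤s n<g) =
  cong (+ F (suc (jOf (2 + n))) -ℤ_)
    (a-fuel-stable _ (≤-trans (2+n∸F[jOf]≤1+n n) n<f) (≤-trans (2+n∸F[jOf]≤1+n n) n<g))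

a-unfold : ∀ n → 2 ≤ n → a n ≡ + F (suc (jOf n)) -ℤ a (n ∸ F (jOf n))
a-unfold (suc zero) (s≤s ())
a-unfold (suc (suc n)) _ =
  cong (+ F (suc (jOf (2 + n))) -ℤ_) (a-fuel-stable _ (2+n∸F[jOf]≤1+n n) ≤-refl)

a-split : ∀ i {k} → 1 ≤ k → k ≤ F (suc i) → a (F (2 + i) + k) ≡ + F (3 + i) -ℤ a k
a-split i {k} 1≤k k≤F = begin
  a n
    ≡⟨ a-unfold n (+-mono-≤ (1≤F[1+n] (suc i)) 1≤k) ⟩
  + F (suc (jOf n)) -ℤ a (n ∸ F (jOf n))
    ≡⟨ cong (λ j → + F (suc j) -ℤ a (n ∸ F j)) jOf-n ⟩
  + F (3 + i) -ℤ a (n ∸ F (2 + i))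
    ≡⟨ cong (λ r → + F (3 + i) -ℤ a r) (m+n∸m≡n (F (2 + i)) k) ⟩
  + F (3 + i) -ℤ a k
    ∎
  where
  open ≡-Reasoning
  n = F (2 + i) + k
  jOf-n : jOf n ≡ 2 + i
  jOf-n = jOf-≡ i (m<m+n (F (2 + i)) 1≤k) (+-monoʳ-≤ (F (2 + i)) k≤F)

i-j<i-k⇔k<j : ∀ i j k → i -ℤ j <ℤ i -ℤ k ⇔ k <ℤ j
i-j<i-k⇔k<j i j k = mk⇔
  (λ lt → ℤ.≰⇒> λ j≤k → ℤ.<⇒≱ lt (ℤ.+-monoʳ-≤ i (ℤ.neg-mono-≤ j≤k)))
  (λ k<j → ℤ.+-monoʳ-< i (ℤ.neg-mono-< k<j))

m≤[m+n]-i<m+n : ∀ {m n i} → + 1 ≤ℤ i → i ≤ℤ + n →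
  + m ≤ℤ + (m + n) -ℤ i × + (m + n) -ℤ i <ℤ + (m + n)
m≤[m+n]-i<m+n {m} {n} {i} 1≤i i≤n = lower , upper
  where
  lower : + m ≤ℤ + (m + n) -ℤ i
  lower = subst (_≤ℤ + (m + n) -ℤ i) (ℤ+.//-rightDividesʳ (+ n) (+ m))
            (ℤ.+-monoʳ-≤ (+ (m + n)) (ℤ.neg-mono-≤ i≤n))
  upper : + (m + n) -ℤ i <ℤ + (m + n)
  upper = subst (+ (m + n) -ℤ i <ℤ_) (ℤ.+-identityʳ (+ (m + n)))
            (Equivalence.from (i-j<i-k⇔k<j (+ (m + n)) i (+ 0))
              (ℤ.<-≤-trans (+<+ (s≤s z≤n)) 1≤i))

a-split-bounds : ∀ i {k} → 1 ≤ k → k ≤ F (suc i) → + 1 ≤ℤ a k → a k ≤ℤ + F (suc i) →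
  + F (2 + i) ≤ℤ a (F (2 + i) + k) × a (F (2 + i) + k) <ℤ + F (3 + i)
a-split-bounds i 1≤k k≤F 1≤ak ak≤F =
  subst (λ v → + F (2 + i) ≤ℤ v × v <ℤ + F (3 + i)) (sym (a-split i 1≤k k≤F))
    (m≤[m+n]-i<m+n 1≤ak ak≤F)

Bounded : ℕ → Set
Bounded j = ∀ n → 1 ≤ n → n ≤ F (suc j) → + 1 ≤ℤ a n × a n ≤ℤ + F (suc j)

bounded-0 : Bounded 0
bounded-0 _ (s≤s z≤n) (s≤s z≤n) = ℤ.≤-refl , ℤ.≤-refl

bounded-step : ∀ j → Bounded j → Bounded (suc j) → Bounded (2 + j)
bounded-step j bounded-j bounded-1+j n 1≤n n≤F with n ≤? F (2 + j)
... | yes n≤F′ =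
  map₂ (λ an≤ → ℤ.≤-trans an≤ (+≤+ (F-≤-suc (2 + j)))) (bounded-1+j n 1≤n n≤F′)
... | no n≰F′ with m<n⇒∃[o>0]m+o≡n (≰⇒> n≰F′)
...   | k , refl , 1≤k = map (ℤ.≤-trans (+≤+ (1≤F[1+n] (suc j)))) ℤ.<⇒≤
                             (uncurry (a-split-bounds j 1≤k k≤F) (bounded-j k 1≤k k≤F))
  where
  k≤F : k ≤ F (suc j)
  k≤F = +-cancelˡ-≤ (F (2 + j)) k (F (suc j)) n≤F

-- Pairing consecutive levels makes the two-step induction structural; Bounded 0 and Bounded 1
-- coincide since F 1 = F 2.
bounded-consecutive : ∀ j → Bounded j × Bounded (suc j)
bounded-consecutive zero = bounded-0 , bounded-0
bounded-consecutive (suc j) =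
  let bounded-j , bounded-1+j = bounded-consecutive j
  in bounded-1+j , bounded-step j bounded-j bounded-1+j

a-bounds : ∀ j → Bounded j
a-bounds j = proj₁ (bounded-consecutive j)

a-block : ∀ i {k} → 1 ≤ k → k ≤ F (suc i) →
  + F (2 + i) ≤ℤ a (F (2 + i) + k) × a (F (2 + i) + k) <ℤ + F (3 + i)
a-block i {k} 1≤k k≤F = uncurry (a-split-bounds i 1≤k k≤F) (a-bounds i k 1≤k k≤F)

a-lower : ∀ s {m} → F (suc s) < m → + F (suc s) ≤ℤ a m
a-lower s {m} F<m with fib-split m (≤-trans (s≤s (1≤F[1+n] s)) F<m)
... | i , k , refl , 1≤k , k≤F =
  ℤ.≤-trans (+≤+ (F-mono-≤ 1+s≤2+i)) (proj₁ (a-block i 1≤k k≤F))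
  where
  1+s≤2+i : suc s ≤ 2 + i
  1+s≤2+i = s≤s⁻¹ (F-cancel-< (<-≤-trans F<m (+-monoʳ-≤ (F (2 + i)) k≤F)))

a-upper : ∀ s {n} → 1 ≤ n → n ≤ F (3 + s) → a n <ℤ + F (3 + s)
a-upper s 1≤n n≤F with m≤n⇒m<n∨m≡n 1≤n
... | inj₂ refl = +<+ (+-mono-≤ (1≤F[1+n] (suc s)) (1≤F[1+n] s))
... | inj₁ 1<n with fib-split _ 1<n
...   | i , k , refl , 1≤k , k≤F =
  ℤ.<-≤-trans (proj₂ (a-block i 1≤k k≤F)) (+≤+ (F-mono-≤ 3+i≤3+s))
  where
  3+i≤3+s : 3 + i ≤ 3 + s
  3+i≤3+s = F-cancel-< (<-≤-trans (m<m+n (F (2 + i)) 1≤k) n≤F)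

-- Suffix minima of a

SuffixMin : ℕ → Set
SuffixMin n = ∀ m → n < m → a n <ℤ a m

Ahead : (ℤ → ℤ → Set) → ℕ → ℕ → Set
Ahead R b x = ∀ y → x < y → y ≤ b → R (a x) (a y)

suffixMin⇔ahead : ∀ s {n} → 1 ≤ n → n ≤ F (3 + s) → SuffixMin n ⇔ Ahead _<ℤ_ (F (3 + s)) n
suffixMin⇔ahead s {n} 1≤n n≤F = mk⇔ (λ min m n<m _ → min m n<m) from
  where
  from : Ahead _<ℤ_ (F (3 + s)) n → SuffixMin n
  from ahead m n<m with m ≤? F (3 + s)
  ... | yes m≤F = ahead m n<m m≤F
  ... | no m≰F = ℤ.<-≤-trans (a-upper s 1≤n n≤F) (a-lower (2 + s) (≰⇒> m≰F))

Reversing : (ℤ → ℤ → Set) → Set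
Reversing R = ∀ c u v → R (c -ℤ u) (c -ℤ v) ⇔ R v u

<-reversing : Reversing _<ℤ_
<-reversing = i-j<i-k⇔k<j

>-reversing : Reversing (flip _<ℤ_)
>-reversing c u v = i-j<i-k⇔k<j c v u

ahead-shift : ∀ {R} → Reversing R → ∀ i {x} → 1 ≤ x → x ≤ F (suc i) →
  Ahead R (F (3 + i)) (F (2 + i) + x) ⇔ Ahead (flip R) (F (suc i)) x
ahead-shift {R} reversing i {x} 1≤x x≤F = mk⇔ to from
  where
  shift : ∀ {y} → 1 ≤ y → y ≤ F (suc i) →
    R (a (F (2 + i) + x)) (a (F (2 + i) + y)) ⇔ R (a y) (a x)
  shift {y} 1≤y y≤F rewrite a-split i 1≤x x≤F | a-split i 1≤y y≤F =
    reversing (+ F (3 + i)) (a x) (a y)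

  to : Ahead R (F (3 + i)) (F (2 + i) + x) → Ahead (flip R) (F (suc i)) x
  to ahead y x<y y≤F = Equivalence.to (shift (≤-trans 1≤x (<⇒≤ x<y)) y≤F)
    (ahead (F (2 + i) + y) (+-monoʳ-< (F (2 + i)) x<y) (+-monoʳ-≤ (F (2 + i)) y≤F))

  from : Ahead (flip R) (F (suc i)) x → Ahead R (F (3 + i)) (F (2 + i) + x)
  from ahead m n<m m≤F with m≤n⇒∃[o]m+o≡n (≤-trans (m≤m+n (F (2 + i)) x) (<⇒≤ n<m))
  ... | y , refl = Equivalence.from (shift (≤-trans 1≤x (<⇒≤ x<y)) y≤F) (ahead y x<y y≤F)
    where
    x<y : x < y
    x<y = +-cancelˡ-< (F (2 + i)) x y n<m
    y≤F : y ≤ F (suc i)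
    y≤F = +-cancelˡ-≤ (F (2 + i)) y (F (suc i)) m≤F

suffixMin-F : ∀ i → SuffixMin (F (3 + i))
suffixMin-F i m F<m = ℤ.<-≤-trans (a-upper i (1≤F[1+n] (2 + i)) ≤-refl) (a-lower (2 + i) F<m)

¬suffixMin-gap : ∀ t {k} → 1 ≤ k → k ≤ F (2 + t) → ¬ SuffixMin (F (4 + t) + k)
¬suffixMin-gap t {k} 1≤k k≤F min = ℤ.<⇒≱ aF<ak (ℤ.≤-trans ak≤F F≤aF)
  where
  k<F : k < F (3 + t)
  k<F = ≤-<-trans k≤F (F[2+n]<F[3+n] t)
  aF<ak : a (F (3 + t)) <ℤ a k
  aF<ak = Equivalence.to (ahead-shift <-reversing (2 + t) 1≤k (<⇒≤ k<F))
            (λ m n<m _ → min m n<m) (F (3 + t)) k<F ≤-refl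
  ak≤F : a k ≤ℤ + F (2 + t)
  ak≤F = proj₂ (a-bounds (suc t) k 1≤k k≤F)
  F≤aF : + F (2 + t) ≤ℤ a (F (3 + t))
  F≤aF = a-lower (suc t) (F[2+n]<F[3+n] t)

suffixMin-nest : ∀ t {l} → 1 ≤ l → l < F (3 + t) →
  SuffixMin (F (6 + t) + (F (4 + t) + l)) ⇔ SuffixMin l
suffixMin-nest t {l} 1≤l l<F = begin
  SuffixMin (F (6 + t) + k)               ∼⟨ suffixMin⇔ahead (4 + t) 1≤n n≤F ⟩
  Ahead _<ℤ_ (F (7 + t)) (F (6 + t) + k)  ∼⟨ ahead-shift <-reversing (4 + t) 1≤k (<⇒≤ k<F) ⟩
  Ahead (flip _<ℤ_) (F (5 + t)) k         ∼⟨ ahead-shift >-reversing (2 + t) 1≤l (<⇒≤ l<F) ⟩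
  Ahead _<ℤ_ (F (3 + t)) l                ∼⟨ ⇔-sym (suffixMin⇔ahead t 1≤l (<⇒≤ l<F)) ⟩
  SuffixMin l                             ∎
  where
  open EquationalReasoning
  k = F (4 + t) + l
  1≤k : 1 ≤ k
  1≤k = ≤-trans 1≤l (m≤n+m l (F (4 + t)))
  k<F : k < F (5 + t)
  k<F = +-monoʳ-< (F (4 + t)) l<F
  1≤n : 1 ≤ F (6 + t) + k
  1≤n = ≤-trans 1≤k (m≤n+m k (F (6 + t)))
  n≤F : F (6 + t) + k ≤ F (7 + t)
  n≤F = +-monoʳ-≤ (F (6 + t)) (<⇒≤ k<F)

-- Zeckendorf digits

greedy-bits-true : ∀ k {r} → F (3 + k) ≤ r →
  greedy-bits (suc k) r ≡ true ∷ greedy-bits k (r ∸ F (3 + k))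
greedy-bits-true k F≤r rewrite ≤⇒≤ᵇ≡true F≤r = refl

greedy-bits-false : ∀ k {r} → r < F (3 + k) → greedy-bits (suc k) r ≡ false ∷ greedy-bits k r
greedy-bits-false k {r} r<F rewrite >⇒≤ᵇ≡false {F (3 + k)} {r} r<F = refl

greedy-bits-0 : ∀ k → greedy-bits k 0 ≡ replicate (suc k) false
greedy-bits-0 zero = refl
greedy-bits-0 (suc k) =
  trans (greedy-bits-false k (1≤F[1+n] (2 + k))) (cong (false ∷_) (greedy-bits-0 k))

greedy-bits-F : ∀ k → greedy-bits k (F (2 + k)) ≡ true ∷ replicate k false
greedy-bits-F zero = refl
greedy-bits-F (suc k) = begin
  greedy-bits (suc k) (F (3 + k))
    ≡⟨ greedy-bits-true k ≤-refl ⟩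
  true ∷ greedy-bits k (F (3 + k) ∸ F (3 + k))
    ≡⟨ cong (λ r → true ∷ greedy-bits k r) (n∸n≡0 (F (3 + k))) ⟩
  true ∷ greedy-bits k 0
    ≡⟨ cong (true ∷_) (greedy-bits-0 k) ⟩
  true ∷ replicate (suc k) false
    ∎
  where open ≡-Reasoning

greedy-bits-F+ : ∀ t {r} → r < F (3 + t) →
  greedy-bits (2 + t) (F (4 + t) + r) ≡ true ∷ false ∷ greedy-bits t r
greedy-bits-F+ t {r} r<F = begin
  greedy-bits (2 + t) (F (4 + t) + r)
    ≡⟨ greedy-bits-true (suc t) (m≤m+n (F (4 + t)) r) ⟩
  true ∷ greedy-bits (suc t) (F (4 + t) + r ∸ F (4 + t))
    ≡⟨ cong (λ r′ → true ∷ greedy-bits (suc t) r′) (m+n∸m≡n (F (4 + t)) r) ⟩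
  true ∷ greedy-bits (suc t) r
    ≡⟨ cong (true ∷_) (greedy-bits-false t r<F) ⟩
  true ∷ false ∷ greedy-bits t r
    ∎
  where open ≡-Reasoning

zeck-greedy-bits : ∀ t {n} → F (2 + t) ≤ n → n < F (3 + t) → zeck n ≡ greedy-bits t n
zeck-greedy-bits t lo hi rewrite topIdx-≡ t lo hi = refl

zeck-F : ∀ i → zeck (F (3 + i)) ≡ true ∷ false ∷ replicate i false
zeck-F i = trans (zeck-greedy-bits (suc i) ≤-refl (F[2+n]<F[3+n] (suc i))) (greedy-bits-F (suc i))

zeck-F+ : ∀ t {r} → r < F (3 + t) → zeck (F (4 + t) + r) ≡ true ∷ false ∷ greedy-bits t r
zeck-F+ t {r} r<F =
  trans (zeck-greedy-bits (2 + t) (m≤m+n (F (4 + t)) r) (+-monoʳ-< (F (4 + t)) r<F))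
        (greedy-bits-F+ t r<F)

zeck-nest : ∀ t {l} → l < F (3 + t) →
  zeck (F (6 + t) + (F (4 + t) + l)) ≡ true ∷ false ∷ true ∷ false ∷ greedy-bits t l
zeck-nest t l<F =
  trans (zeck-F+ (2 + t) (+-monoʳ-< (F (4 + t)) l<F))
        (cong (λ w → true ∷ false ∷ w) (greedy-bits-F+ t l<F))

greedy-bits-pads-zeck : ∀ k {r} → 1 ≤ r → r < F (3 + k) →
  ∃[ z ] ∃[ x ] greedy-bits k r ≡ replicate z false ++ zeck r × zeck r ≡ true ∷ x
greedy-bits-pads-zeck zero {suc zero} _ _ = 0 , [] , refl , refl
greedy-bits-pads-zeck zero {suc (suc r)} _ (s≤s (s≤s ()))
greedy-bits-pads-zeck (suc k) {r} 1≤r r<F with F (3 + k) ≤? r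
... | yes F≤r =
  0 , greedy-bits k (r ∸ F (3 + k)) , sym zeck≡ , trans zeck≡ (greedy-bits-true k F≤r)
  where
  zeck≡ : zeck r ≡ greedy-bits (suc k) r
  zeck≡ = zeck-greedy-bits (suc k) F≤r r<F
... | no F≰r with greedy-bits-pads-zeck k 1≤r (≰⇒> F≰r)
...   | z , x , padded , head =
  suc z , x , trans (greedy-bits-false k (≰⇒> F≰r)) (cong (false ∷_) padded) , head

Zeros : List Bool → Set
Zeros = All (_≡ false)

-- The languages 10(100*10)*0*, (100*10)*0* and 0*10(100*10)*0*, as a deterministic grammar so
-- that non-membership is refuted by pattern matching.
data Lang : List Bool → Set
data Tail : List Bool → Set
data OpenBlock : List Bool → Set

data Lang where
  lang : ∀ {w} → Tail w → Lang (true ∷ false ∷ w)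

data Tail where
  zeros : ∀ {w} → Zeros w → Tail w
  block : ∀ {w} → OpenBlock w → Tail (true ∷ false ∷ w)

data OpenBlock where
  skip  : ∀ {w} → OpenBlock w → OpenBlock (false ∷ w)
  close : ∀ {w} → Lang w → OpenBlock w

skips : ∀ {z w} → Zeros z → OpenBlock w → OpenBlock (z ++ w)
skips [] ob = ob
skips (refl ∷ zs) ob = skip (skips zs ob)

unskip : ∀ z {x} → OpenBlock (replicate z false ++ true ∷ x) → Lang (true ∷ x)
unskip zero (close l) = l
unskip (suc z) (skip ob) = unskip z ob
unskip (suc z) (close ())

¬OpenBlock-0* : ∀ z → ¬ OpenBlock (replicate z false)
¬OpenBlock-0* zero (close ())
¬OpenBlock-0* (suc z) (skip ob) = ¬OpenBlock-0* z ob
¬OpenBlock-0* (suc z) (close ())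

Lang-100* : ∀ z → Lang (true ∷ false ∷ replicate z false)
Lang-100* z = lang (zeros (replicate⁺ z refl))

¬Lang-1000*1 : ∀ z x → ¬ Lang (true ∷ false ∷ false ∷ replicate z false ++ true ∷ x)
¬Lang-1000*1 z x (lang (zeros (_ ∷ zs))) with ++⁻ʳ (replicate z false) zs
... | () ∷ _

¬Lang-1010* : ∀ z → ¬ Lang (true ∷ false ∷ true ∷ replicate z false)
¬Lang-1010* zero (lang (zeros (() ∷ _)))
¬Lang-1010* (suc z) (lang (zeros (() ∷ _)))
¬Lang-1010* (suc z) (lang (block ob)) = ¬OpenBlock-0* z ob

Lang-10100*-shift : ∀ z x →
  Lang (true ∷ false ∷ true ∷ false ∷ replicate z false ++ true ∷ x) ⇔ Lang (true ∷ x)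
Lang-10100*-shift z x = mk⇔ to (λ l → lang (block (skips (replicate⁺ z refl) (close l))))
  where
  to : Lang (true ∷ false ∷ true ∷ false ∷ replicate z false ++ true ∷ x) → Lang (true ∷ x)
  to (lang (zeros (() ∷ _)))
  to (lang (block ob)) = unskip z ob

blockExp tailExp : Exp
blockExp = b1 ∙ b0 ∙ b0 ⋆ ∙ b1 ∙ b0
tailExp = blockExp ⋆ ∙ b0 ⋆

∈-∙⁺ : ∀ {u v e f} → u ∈L e → v ∈L f → (u ++ v) ∈L (e ∙ f)
∈-∙⁺ {u} {v} = prod (u Appending.++ v)

∈-∙⁻ : ∀ {w e f} → w ∈L (e ∙ f) → ∃[ u ] ∃[ v ] u ++ v ≡ w × u ∈L e × v ∈L f
∈-∙⁻ (prod app u∈ v∈) = _ , _ , Appending.break app , u∈ , v∈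

∈-⋆-[] : ∀ {e} → [] ∈L (e ⋆)
∈-⋆-[] = star (sum (inj₁ []∈ε))

∈-⋆-++ : ∀ {u v e} → u ∈L e → v ∈L (e ⋆) → (u ++ v) ∈L (e ⋆)
∈-⋆-++ u∈ v∈ = star (sum (inj₂ (∈-∙⁺ u∈ v∈)))

∈b0 : (false ∷ []) ∈L b0
∈b0 = [ here [ refl ] ]

∈b1 : (true ∷ []) ∈L b1
∈b1 = [ here [ refl ] ]

zeros⇒∈0* : ∀ {w} → Zeros w → w ∈L (b0 ⋆)
zeros⇒∈0* [] = ∈-⋆-[]
zeros⇒∈0* (refl ∷ zs) = ∈-⋆-++ ∈b0 (zeros⇒∈0* zs)

∈0*⇒zeros : ∀ {w} → w ∈L (b0 ⋆) → Zeros w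
∈0*⇒zeros (star (sum (inj₁ []∈ε))) = []
∈0*⇒zeros (star (sum (inj₂ (prod app [ here [ refl ] ] w∈)))) with Appending.break app
... | refl = refl ∷ ∈0*⇒zeros w∈

∈block⁺ : ∀ {z} → Zeros z → (true ∷ false ∷ z ++ true ∷ false ∷ []) ∈L blockExp
∈block⁺ zs = ∈-∙⁺ ∈b1 (∈-∙⁺ ∈b0 (∈-∙⁺ (zeros⇒∈0* zs) (∈-∙⁺ ∈b1 ∈b0)))

∈block⁻ : ∀ {g} → g ∈L blockExp → ∃[ z ] Zeros z × g ≡ true ∷ false ∷ z ++ true ∷ false ∷ []
∈block⁻ (prod app₁ [ here [ refl ] ] (prod app₂ [ here [ refl ] ]
          (prod app₃ z∈ (prod app₄ [ here [ refl ] ] [ here [ refl ] ]))))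
  with Appending.break app₄ | Appending.break app₃ | Appending.break app₂ | Appending.break app₁
... | refl | refl | refl | refl = _ , ∈0*⇒zeros z∈ , refl

block-++ : ∀ z u v →
  ((true ∷ false ∷ z ++ true ∷ false ∷ []) ++ u) ++ v ≡ true ∷ false ∷ z ++ true ∷ false ∷ u ++ v
block-++ z u v =
  cong (λ w → true ∷ false ∷ w)
    (trans (++-assoc (z ++ true ∷ false ∷ []) u v) (++-assoc z _ (u ++ v)))

∈tail-block : ∀ {z t} → Zeros z → t ∈L tailExp →
  (true ∷ false ∷ z ++ true ∷ false ∷ t) ∈L tailExp
∈tail-block {z} zs t∈ with ∈-∙⁻ t∈
... | u , v , refl , u∈ , v∈ =
  subst (_∈L tailExp) (block-++ z u v) (∈-∙⁺ (∈-⋆-++ (∈block⁺ zs) u∈) v∈)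

tail-sound : ∀ {w} → Tail w → w ∈L tailExp
openBlock-sound : ∀ {w} → OpenBlock w →
  ∃[ z ] ∃[ t ] Zeros z × w ≡ z ++ true ∷ false ∷ t × t ∈L tailExp

tail-sound (zeros zs) = ∈-∙⁺ {u = []} ∈-⋆-[] (zeros⇒∈0* zs)
tail-sound (block ob) with openBlock-sound ob
... | z , t , zs , refl , t∈ = ∈tail-block zs t∈

openBlock-sound (skip ob) with openBlock-sound ob
... | z , t , zs , refl , t∈ = false ∷ z , t , refl ∷ zs , refl , t∈
openBlock-sound (close (lang t)) = [] , _ , [] , refl , tail-sound t

⋆-block-complete : ∀ {u v} → u ∈L (blockExp ⋆) → Zeros v → Tail (u ++ v)
⋆-block-complete (star (sum (inj₁ []∈ε))) zv = zeros zv
⋆-block-complete {v = v} (star (sum (inj₂ (prod app g∈ u∈)))) zv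
  with Appending.break app | ∈block⁻ g∈
... | refl | z , zs , refl =
  subst Tail (sym (block-++ z _ v)) (block (skips zs (close (lang (⋆-block-complete u∈ zv)))))

tail-complete : ∀ {w} → w ∈L tailExp → Tail w
tail-complete w∈ with ∈-∙⁻ w∈
... | u , v , refl , u∈ , v∈ = ⋆-block-complete u∈ (∈0*⇒zeros v∈)

Lang⇔language : ∀ {w} → Lang w ⇔ w ∈L language
Lang⇔language = mk⇔ (λ { (lang t) → ∈-∙⁺ ∈b1 (∈-∙⁺ ∈b0 (tail-sound t)) }) from
  where
  from : ∀ {w} → w ∈L language → Lang w
  from (prod app₁ [ here [ refl ] ] (prod app₂ [ here [ refl ] ] w∈))
    with Appending.break app₂ | Appending.break app₁
  ... | refl | refl = lang (tail-complete w∈)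

¬Lang-10-greedy-bits : ∀ t {k} → 1 ≤ k → k ≤ F (2 + t) → ¬ Lang (true ∷ false ∷ greedy-bits t k)
¬Lang-10-greedy-bits t 1≤k k≤F with m≤n⇒m<n∨m≡n k≤F
¬Lang-10-greedy-bits t 1≤k k≤F | inj₂ refl rewrite greedy-bits-F t = ¬Lang-1010* t
¬Lang-10-greedy-bits zero 1≤k k≤F | inj₁ k<1 = ⊥-elim (<⇒≱ k<1 1≤k)
¬Lang-10-greedy-bits (suc t) 1≤k k≤F | inj₁ k<F with greedy-bits-pads-zeck t 1≤k k<F
... | z , x , padded , head rewrite greedy-bits-false t k<F | padded | head = ¬Lang-1000*1 z x

¬Lang-zeck-gap : ∀ t {k} → 1 ≤ k → k ≤ F (2 + t) → ¬ Lang (zeck (F (4 + t) + k))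
¬Lang-zeck-gap t 1≤k k≤F rewrite zeck-F+ t (≤-<-trans k≤F (F[2+n]<F[3+n] t)) =
  ¬Lang-10-greedy-bits t 1≤k k≤F

Lang-zeck-nest : ∀ t {l} → 1 ≤ l → l < F (3 + t) →
  Lang (zeck (F (6 + t) + (F (4 + t) + l))) ⇔ Lang (zeck l)
Lang-zeck-nest t 1≤l l<F with greedy-bits-pads-zeck t 1≤l l<F
... | z , x , padded , head rewrite zeck-nest t l<F | padded | head = Lang-10100*-shift z x

suffixMin⇔Lang : ∀ n → 1 ≤ n → SuffixMin n ⇔ Lang (zeck n)
suffixMin⇔Lang = <-rec _ step
  where
  step : ∀ n → (∀ {m} → m < n → 1 ≤ m → SuffixMin m ⇔ Lang (zeck m)) →
    1 ≤ n → SuffixMin n ⇔ Lang (zeck n)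
  step n ih 1≤n with shape n 1≤n
  ... | one = mk⇔ (λ min → ⊥-elim (ℤ.<-irrefl refl (min 2 (s≤s (s≤s z≤n))))) (λ ())
  ... | fib t = mk⇔ (λ _ → subst Lang (sym (zeck-F t)) (Lang-100* t)) (λ _ → suffixMin-F t)
  ... | gap t 1≤k k≤F =
    mk⇔ (⊥-elim ∘ ¬suffixMin-gap t 1≤k k≤F) (⊥-elim ∘ ¬Lang-zeck-gap t 1≤k k≤F)
  ... | nest t {l} 1≤l l<F = begin
    _             ∼⟨ suffixMin-nest t 1≤l l<F ⟩
    SuffixMin l   ∼⟨ ih l<n 1≤l ⟩
    Lang (zeck l) ∼⟨ ⇔-sym (Lang-zeck-nest t 1≤l l<F) ⟩
    _             ∎
    where
    open EquationalReasoning
    l<n : l < F (6 + t) + (F (4 + t) + l)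
    l<n = ≤-<-trans (m≤n+m l (F (4 + t))) (m<n+m _ (1≤F[1+n] (5 + t)))

theorem8 : (n : ℕ) → 0 < n →
    ((∀ m → n < m → a n <ℤ a m) ⇔ (zeck n ∈L language))
theorem8 n 1≤n = Lang⇔language ⇔-∘ suffixMin⇔Lang n 1≤n
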